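{- Let $\Pi$ be a GSP of an SF instance $I$, and let $a_i\neq a_j$ be fully matched in the half-matching associated with $\Pi$, i.e. $|\{s:\Pi_s(a_i)=a_j\}|+|\{s:\Pi_s(a_j)=a_i\}|=2$. Then there exists a permutation $\Pi_r\in\Pi$ such that $\Pi_r=(a_i\ a_j)$.
   Context: A Stable Fixtures (SF) instance is $I=(A,\succ,c)$ where $A=\{a_1,\dots,a_n\}$ is a finite set of $n$ agents; each agent $a_i$ has a strict linear order $\succ_i$ over $A\setminus\{a_i\}$ (complete preference list), with the convention that every agent ranks itself last ($a_j\succ_i a_i$ for all $j\neq i$); $a\succeq_i b$ means $a\succ_i b$ or $a=b$. Each agent has an integer capacity $c_i$ with $1\le c_i<n$. A cyclic permutation of a nonempty set $A_r\subseteq A$ is a permutation $\Pi_r$ of $A_r$ consisting of a single cycle of length $|A_r|$ (length 1: a fixed point $(a_i)$; length 2: a transposition $(a_i\ a_j)$). Two cyclic permutations are distinct if some element is mapped to different elements by them. A GSP (generalised stable partition) of $I$ is a finite collection $\Pi=\{\Pi_1,\dots,\Pi_k\}$ of cyclic permutations $\Pi_r$ of sets $A_r\subseteq A$, pairwise distinct except that fixed points may be repeated, such that: (F1) for every $r$ and every $a_j\in A_r$, $\Pi_r(a_j)\succeq_j\Pi_r^{ -1}(a_j)$; (F2) there are no distinct $a_i,a_j\in A$ with the transposition $(a_i\ a_j)\notin\Pi$ such that $a_j\succ_i\Pi_r^{ -1}(a_i)$ and $a_i\succ_j\Pi_s^{ -1}(a_j)$ for some $\Pi_r,\Pi_s\in\Pi$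 with $a_i\in A_r$, $a_j\in A_s$; (F3) for every $a_i\in A$, the number of indices $r$ with $a_i\in A_r$ equals $c_i$; (F4) for all distinct $a_i,a_j\in A$, $|\{s:\Pi_s(a_i)=a_j\}|+|\{s:\Pi_s(a_j)=a_i\}|\le 2$. In the half-matching associated with $\Pi$, each predecessor–successor pair $\{a,\Pi_r(a)\}$ ($a\in A_r$, $\Pi_r(a)\neq a$) in a cycle counts as a half-match, and two half-matches between the same two agents form a full match. -}

module Defs where

open import Data.Nat using (ℕ; zero; suc; _+_; _<_; _≤_)
open import Data.Fin using (Fin; zero; suc)
open import Data.Fin.Properties using (_≟_)
open import Data.Bool using (Bool; true; false; _∧_; _∨_; T)
open import Data.List using (List; []; _∷_; length)
open import Data.List.Membership.Propositional using (_∈_)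
open import Data.List.Relation.Unary.Unique.Propositional using (Unique)
open import Data.Product using (Σ; ∃; ∃-syntax; _×_; _,_)
open import Data.Sum using (_⊎_)
open import Relation.Nullary using (¬_)
open import Relation.Nullary.Decidable using (⌊_⌋)
open import Relation.Binary.PropositionalEquality using (_≡_; _≢_)
open import Function.Definitions using (Injective)

-- The strict preference order of
-- agent i is encoded by an injective rank function  rank i : Fin n → ℕ
-- (smaller rank = more preferred); this is exactly a strict linear
-- order on all agents, and every agent ranks itself last.

record SF (n : ℕ) : Set where
  field
    rank        : Fin n → Fin n → ℕ
    rank-inj    : ∀ i → Injective _≡_ _≡_ (rank i)
    self-last   : ∀ i j → j ≢ i → rank i j < rank i i
    cap         : Fin n → ℕ
    cap-pos     : ∀ i → 1 ≤ cap i
    cap-bound   : ∀ i → cap i < n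

  _≻[_]_ : Fin n → Fin n → Fin n → Set
  a ≻[ i ] b = rank i a < rank i b

  _⪰[_]_ : Fin n → Fin n → Fin n → Set
  a ⪰[ i ] b = a ≻[ i ] b ⊎ a ≡ b

-- A cyclic permutation of a nonempty set A_r of
-- agents is given by a nonempty duplicate-free list  x₀ ∷ … ∷ x_{k-1};
-- its underlying set is the set of list elements, and it maps
-- x_m ↦ x_{m+1} and x_{k-1} ↦ x₀  (a one-element list is a fixed point).

countFin : ∀ {K} → (Fin K → Bool) → ℕ
countFin {zero} p = 0
countFin {suc K} p with p zero
... | true  = suc (countFin (λ s → p (suc s)))
... | false = countFin (λ s → p (suc s))


module _ {n : ℕ} where

  eqb : Fin n → Fin n → Bool
  eqb a b = ⌊ a ≟ b ⌋

  consec : List (Fin n) → Fin n → Fin n → Bool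
  consec (x ∷ y ∷ xs) a b = (eqb x a ∧ eqb y b) ∨ consec (y ∷ xs) a b
  consec _ a b = false

  lastIs : List (Fin n) → Fin n → Bool
  lastIs [] a = false
  lastIs (x ∷ []) a = eqb x a
  lastIs (x ∷ y ∷ xs) a = lastIs (y ∷ xs) a

  maps : List (Fin n) → Fin n → Fin n → Bool
  maps [] a b = false
  maps (x ∷ xs) a b = consec (x ∷ xs) a b ∨ (lastIs (x ∷ xs) a ∧ eqb x b)

  memb : Fin n → List (Fin n) → Bool
  memb a [] = false
  memb a (x ∷ xs) = eqb x a ∨ memb a xs

  record IsCycle (C : List (Fin n)) : Set where
    field
      nonempty : C ≢ []
      unique   : Unique C

  DistinctCycles : List (Fin n) → List (Fin n) → Set
  DistinctCycles C D = ∃[ a ] ∃[ b ] (maps C a b ≢ maps D a b)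

  IsFixedPoint : List (Fin n) → Set
  IsFixedPoint C = length C ≡ 1

  IsTransposition : List (Fin n) → Fin n → Fin n → Set
  IsTransposition C a b = (C ≡ a ∷ b ∷ []) ⊎ (C ≡ b ∷ a ∷ [])

module _ {n : ℕ} (I : SF n) where
  open SF I

  nMaps : ∀ {K} → (Fin K → List (Fin n)) → Fin n → Fin n → ℕ
  nMaps Π a b = countFin (λ s → maps (Π s) a b)

  record IsGSP {K : ℕ} (Π : Fin K → List (Fin n)) : Set where
    field
      cycles   : ∀ r → IsCycle {n} (Π r)
      distinct : ∀ r s → r ≢ s →
                 (IsFixedPoint (Π r) × IsFixedPoint (Π s)) ⊎ DistinctCycles (Π r) (Π s)
      F1 : ∀ r a succ pred → T (maps (Π r) a succ) → T (maps (Π r) pred a) →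
           succ ⪰[ a ] pred
      -- (F2)  no blocking pair
      F2 : ∀ i j → i ≢ j → ¬ (∃[ r ] IsTransposition (Π r) i j) →
           ¬ ((∃[ r ] ∃[ p ] (T (maps (Π r) p i) × j ≻[ i ] p)) ×
              (∃[ s ] ∃[ q ] (T (maps (Π s) q j) × i ≻[ j ] q)))
      F3 : ∀ a → countFin (λ r → memb a (Π r)) ≡ cap a
      F4 : ∀ (i j : Fin n) → i ≢ j → nMaps Π i j + nMaps Π j i ≤ 2

module Submission where

-- Suppose no Π_r is the transposition (a_i a_j).  Every cycle carrying a half-match between
-- a_i and a_j then has length at least 3, and in such a cycle each agent strictly prefers its
-- successor to its predecessor, by (F1).  If the two half-matches point in opposite directions,
-- a_i and a_j each prefer the other to one of their predecessors: a blocking pair against (F2).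
-- If both point the same way, two distinct long cycles share a_i.  But an agent a has the same
-- predecessor in all long cycles: if p, its predecessor in one of them, were better than its
-- predecessor in another, then (a, p) would block, as (F4) rules out the transposition (a p).
-- Hence long cycles sharing an agent consist of the same agents and induce the same map,
-- contradicting distinctness.

open import Defs
open import Data.Nat using (ℕ; zero; suc; _+_; _≤_; z≤n; s≤s)
open import Data.Nat.Properties using (<-cmp; <-irrefl; ≤-refl; ≤-trans; +-mono-≤; m≤n⇒m≤1+n)
open import Data.Fin using (Fin; zero; suc)
open import Data.Fin.Properties using (_≟_; suc-injective; any?)
open import Data.Bool using (Bool; true; false; T; _∧_; _∨_)
open import Data.Bool.Properties using (T-∧; T-∨; T-≡; ⇔→≡)
open import Data.List using (List; []; _∷_; length)
open import Data.List.Properties using (≡-dec)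
open import Data.List.Membership.Propositional using (_∈_)
open import Data.List.Relation.Unary.Any using (here; there)
open import Data.List.Relation.Unary.AllPairs using (_∷_)
open import Data.List.Relation.Unary.Unique.Propositional using (Unique)
open import Data.List.Relation.Unary.Unique.Propositional.Properties using (Unique[x∷xs]⇒x∉xs)
open import Data.Product using (∃-syntax; _×_; _,_; proj₁; proj₂; map₂)
open import Data.Sum using (_⊎_; inj₁; inj₂; swap; [_,_]′)
open import Data.Empty using (⊥-elim)
open import Function.Base using (_∘′_)
open import Function.Bundles using (Equivalence; mk⇔)
open import Relation.Nullary using (¬_; Dec; yes; no)
open import Relation.Nullary.Decidable using (toWitness; fromWitness; _⊎-dec_)
open import Relation.Binary.Definitions using (tri<; tri≈; tri>)
open import Relation.Binary.PropositionalEquality using (_≡_; _≢_; refl; sym; cong; subst; subst₂)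

module _ {A : Set} where

  data Consec : List A → A → A → Set where
    here  : ∀ {a b xs} → Consec (a ∷ b ∷ xs) a b
    there : ∀ {x y xs a b} → Consec (y ∷ xs) a b → Consec (x ∷ y ∷ xs) a b

  data Last : List A → A → Set where
    here  : ∀ {a} → Last (a ∷ []) a
    there : ∀ {x y xs a} → Last (y ∷ xs) a → Last (x ∷ y ∷ xs) a

  data Maps : List A → A → A → Set where
    step : ∀ {xs a b} → Consec xs a b → Maps xs a b
    wrap : ∀ {x xs a} → Last (x ∷ xs) a → Maps (x ∷ xs) a x

  Long : List A → Set
  Long xs = 3 ≤ length xs

  private variable
    a b c l x : A
    xs : List A

  Consec⇒∈ˡ : Consec xs a b → a ∈ xs
  Consec⇒∈ˡ here      = here refl
  Consec⇒∈ˡ (there c) = there (Consec⇒∈ˡ c)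

  Consec⇒∈ʳ : Consec xs a b → b ∈ xs
  Consec⇒∈ʳ here      = there (here refl)
  Consec⇒∈ʳ (there c) = there (Consec⇒∈ʳ c)

  Last⇒∈ : Last xs a → a ∈ xs
  Last⇒∈ here      = here refl
  Last⇒∈ (there l) = there (Last⇒∈ l)

  Maps⇒∈ˡ : Maps xs a b → a ∈ xs
  Maps⇒∈ˡ (step c) = Consec⇒∈ˡ c
  Maps⇒∈ˡ (wrap l) = Last⇒∈ l

  Maps⇒∈ʳ : Maps xs a b → b ∈ xs
  Maps⇒∈ʳ (step c) = Consec⇒∈ʳ c
  Maps⇒∈ʳ (wrap l) = here refl

  ∃-Last : ∀ x xs → ∃[ l ] Last (x ∷ xs) l
  ∃-Last x []       = x , here
  ∃-Last x (y ∷ ys) = map₂ there (∃-Last y ys)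

  ∈-tail⇒∃-Consec : a ∈ xs → ∃[ p ] Consec (x ∷ xs) p a
  ∈-tail⇒∃-Consec {x = x} (here refl) = x , here
  ∈-tail⇒∃-Consec (there a∈xs)        = map₂ there (∈-tail⇒∃-Consec a∈xs)

  ∈⇒∃-pred : a ∈ xs → ∃[ p ] Maps xs p a
  ∈⇒∃-pred {xs = x ∷ xs} (here refl)  = map₂ wrap (∃-Last x xs)
  ∈⇒∃-pred {xs = x ∷ xs} (there a∈xs) = map₂ step (∈-tail⇒∃-Consec a∈xs)

  Consec-asym : Unique xs → Consec xs a b → ¬ Consec xs b a
  Consec-asym u       here      here      = Unique[x∷xs]⇒x∉xs u (here refl)
  Consec-asym u       here      (there d) = Unique[x∷xs]⇒x∉xs u (Consec⇒∈ʳ d)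
  Consec-asym u       (there c) here      = Unique[x∷xs]⇒x∉xs u (Consec⇒∈ʳ c)
  Consec-asym (_ ∷ u) (there c) (there d) = Consec-asym u c d

  Last-head : Unique (x ∷ xs) → Last (x ∷ xs) x → xs ≡ []
  Last-head u here      = refl
  Last-head u (there l) = ⊥-elim (Unique[x∷xs]⇒x∉xs u (Last⇒∈ l))

  Consec-head-Last⇒¬Long : Unique (x ∷ xs) → Consec (x ∷ xs) x b → Last (x ∷ xs) b → ¬ Long (x ∷ xs)
  Consec-head-Last⇒¬Long (_ ∷ u) here (there l) long with Last-head u l
  Consec-head-Last⇒¬Long _ here (there l) (s≤s (s≤s ())) | refl
  Consec-head-Last⇒¬Long u (there c) l _ = Unique[x∷xs]⇒x∉xs u (Consec⇒∈ˡ c)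

  Maps-asym : Unique xs → Long xs → Maps xs a b → ¬ Maps xs b a
  Maps-asym u _    (step c) (step d) = Consec-asym u c d
  Maps-asym u long (step c) (wrap l) = Consec-head-Last⇒¬Long u c l long
  Maps-asym u long (wrap l) (step d) = Consec-head-Last⇒¬Long u d l long
  Maps-asym u long (wrap l) (wrap _) with Last-head u l
  Maps-asym u (s≤s ()) (wrap l) (wrap _) | refl

  Maps-irrefl : Unique xs → Long xs → ¬ Maps xs a a
  Maps-irrefl u long m = Maps-asym u long m m

  module _ (P : A → Set) where

    private
      toHead : (∀ {a b} → Consec (x ∷ xs) a b → P b → P a) → c ∈ x ∷ xs → P c → P x
      toHead closed (here refl) pc = pc
      toHead {xs = _ ∷ _} closed (there c∈xs) pc = closed here (toHead (λ d → closed (there d)) c∈xs pc)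

      fromLast : (∀ {a b} → Consec (x ∷ xs) a b → P b → P a) → Last (x ∷ xs) l → P l → ∀ {y} → y ∈ x ∷ xs → P y
      fromLast closed here      pl (here refl)  = pl
      fromLast closed (there l) pl (here refl)  = closed here (fromLast (λ d → closed (there d)) l pl (here refl))
      fromLast closed (there l) pl (there y∈xs) = fromLast (λ d → closed (there d)) l pl y∈xs

    pred-closed⇒∀∈ : (∀ {a b} → Maps xs a b → P b → P a) → c ∈ xs → P c → ∀ {y} → y ∈ xs → P y
    pred-closed⇒∀∈ {xs = x ∷ xs} closed c∈xs pc with ∃-Last x xs
    ... | l , last =
      fromLast (λ d → closed (step d)) last (closed (wrap last) (toHead (λ d → closed (step d)) c∈xs pc))

module _ {n : ℕ} where

  private variable
    a b : Fin n
    C D : List (Fin n)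

  private
    ∨-introˡ : ∀ x y → T x → T (x ∨ y)
    ∨-introˡ x y = Equivalence.from (T-∨ {x} {y}) ∘′ inj₁

    ∨-introʳ : ∀ x y → T y → T (x ∨ y)
    ∨-introʳ x y = Equivalence.from (T-∨ {x} {y}) ∘′ inj₂

    ∧-intro : ∀ x y → T x → T y → T (x ∧ y)
    ∧-intro x y tx ty = Equivalence.from (T-∧ {x} {y}) (tx , ty)

    eqb-refl : (a : Fin n) → T (eqb a a)
    eqb-refl _ = fromWitness refl

  consec⇒Consec : ∀ C → T (consec C a b) → Consec C a b
  consec⇒Consec {a} {b} (x ∷ y ∷ xs) t =
    [ (λ h → let x≡a , y≡b = Equivalence.to (T-∧ {eqb x a}) h in
             subst₂ (Consec (x ∷ y ∷ xs)) (toWitness x≡a) (toWitness y≡b) here)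
    , (λ t′ → there (consec⇒Consec (y ∷ xs) t′)) ]′
    (Equivalence.to (T-∨ {eqb x a ∧ eqb y b}) t)

  Consec⇒consec : Consec C a b → T (consec C a b)
  Consec⇒consec {a ∷ b ∷ xs} here =
    ∨-introˡ (eqb a a ∧ eqb b b) (consec (b ∷ xs) a b) (∧-intro (eqb a a) (eqb b b) (eqb-refl a) (eqb-refl b))
  Consec⇒consec {x ∷ y ∷ xs} {a} {b} (there c) =
    ∨-introʳ (eqb x a ∧ eqb y b) (consec (y ∷ xs) a b) (Consec⇒consec c)

  lastIs⇒Last : ∀ C → T (lastIs C a) → Last C a
  lastIs⇒Last {a} (x ∷ []) t with x ≟ a
  ... | yes refl = here
  ... | no _     = ⊥-elim t
  lastIs⇒Last (x ∷ y ∷ xs) t = there (lastIs⇒Last (y ∷ xs) t)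

  Last⇒lastIs : Last C a → T (lastIs C a)
  Last⇒lastIs here      = eqb-refl _
  Last⇒lastIs (there l) = Last⇒lastIs l

  maps⇒Maps : ∀ C → T (maps C a b) → Maps C a b
  maps⇒Maps {a} {b} (x ∷ xs) t with Equivalence.to (T-∨ {consec (x ∷ xs) a b}) t
  ... | inj₁ c = step (consec⇒Consec (x ∷ xs) c)
  ... | inj₂ w with Equivalence.to (T-∧ {lastIs (x ∷ xs) a}) w
  ... | l , x≡b with refl ← toWitness x≡b = wrap (lastIs⇒Last (x ∷ xs) l)

  Maps⇒maps : Maps C a b → T (maps C a b)
  Maps⇒maps {x ∷ xs} {a} {b} (step c) =
    ∨-introˡ (consec (x ∷ xs) a b) (lastIs (x ∷ xs) a ∧ eqb x b) (Consec⇒consec c)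
  Maps⇒maps {x ∷ xs} {a} (wrap l) =
    ∨-introʳ (consec (x ∷ xs) a x) (lastIs (x ∷ xs) a ∧ eqb x x)
      (∧-intro (lastIs (x ∷ xs) a) (eqb x x) (Last⇒lastIs l) (eqb-refl x))

  maps-cong : (Maps C a b → Maps D a b) → (Maps D a b → Maps C a b) → maps C a b ≡ maps D a b
  maps-cong {C} {a} {b} {D} C⇒D D⇒C = ⇔→≡ {z = true} (mk⇔ (transport C⇒D) (transport D⇒C))
    where
      transport : ∀ {E F} → (Maps E a b → Maps F a b) → maps E a b ≡ true → maps F a b ≡ true
      transport {E} {F} E⇒F e = Equivalence.to T-≡ (Maps⇒maps (E⇒F (maps⇒Maps E (Equivalence.from T-≡ e))))

  IsTransposition⇒Maps : IsTransposition C a b → Maps C a b × Maps C b a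
  IsTransposition⇒Maps (inj₁ refl) = step here , wrap (there here)
  IsTransposition⇒Maps (inj₂ refl) = wrap (there here) , step here

  IsTransposition⇒¬Long : IsTransposition C a b → ¬ Long C
  IsTransposition⇒¬Long (inj₁ refl) (s≤s (s≤s ()))
  IsTransposition⇒¬Long (inj₂ refl) (s≤s (s≤s ()))

  Maps⇒IsTransposition⊎Long : Maps C a b → a ≢ b → IsTransposition C a b ⊎ Long C
  Maps⇒IsTransposition⊎Long {_ ∷ []}          (wrap here)         a≢b = ⊥-elim (a≢b refl)
  Maps⇒IsTransposition⊎Long {_ ∷ _ ∷ []}      (step here)         _   = inj₁ (inj₁ refl)
  Maps⇒IsTransposition⊎Long {_ ∷ _ ∷ []}      (wrap (there here)) _   = inj₁ (inj₂ refl)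
  Maps⇒IsTransposition⊎Long {_ ∷ _ ∷ _ ∷ _} _                     _   = inj₂ (s≤s (s≤s (s≤s z≤n)))

  Long⇒¬IsFixedPoint : Long C → ¬ IsFixedPoint C
  Long⇒¬IsFixedPoint {_ ∷ []} (s≤s ()) _
  Long⇒¬IsFixedPoint {_ ∷ _ ∷ _} _ ()

  IsTransposition? : ∀ (C : List (Fin n)) a b → Dec (IsTransposition C a b)
  IsTransposition? C a b = ≡-dec _≟_ C (a ∷ b ∷ []) ⊎-dec ≡-dec _≟_ C (b ∷ a ∷ [])

∃⇒countFin≥1 : ∀ {K} (p : Fin K → Bool) s → T (p s) → 1 ≤ countFin p
∃⇒countFin≥1 p zero t with p zero
... | true  = s≤s z≤n
... | false = ⊥-elim t
∃⇒countFin≥1 p (suc s) t with p zero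
... | true  = s≤s z≤n
... | false = ∃⇒countFin≥1 (p ∘′ suc) s t

∃₂⇒countFin≥2 : ∀ {K} (p : Fin K → Bool) r s → r ≢ s → T (p r) → T (p s) → 2 ≤ countFin p
∃₂⇒countFin≥2 p zero    zero    r≢s _  _  = ⊥-elim (r≢s refl)
∃₂⇒countFin≥2 p zero    (suc s) _   tr ts with p zero
... | true  = s≤s (∃⇒countFin≥1 (p ∘′ suc) s ts)
... | false = ⊥-elim tr
∃₂⇒countFin≥2 p (suc r) zero    _   tr ts with p zero
... | true  = s≤s (∃⇒countFin≥1 (p ∘′ suc) r tr)
... | false = ⊥-elim ts
∃₂⇒countFin≥2 p (suc r) (suc s) r≢s tr ts with p zero
... | true  = m≤n⇒m≤1+n (∃₂⇒countFin≥2 (p ∘′ suc) r s (r≢s ∘′ cong suc) tr ts)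
... | false = ∃₂⇒countFin≥2 (p ∘′ suc) r s (r≢s ∘′ cong suc) tr ts

countFin≥1⇒∃ : ∀ {K} (p : Fin K → Bool) → 1 ≤ countFin p → ∃[ s ] T (p s)
countFin≥1⇒∃ {suc K} p h with p zero in eq
... | true  = zero , subst T (sym eq) _
... | false with countFin≥1⇒∃ (p ∘′ suc) h
... | s , ts = suc s , ts

countFin≥2⇒∃₂ : ∀ {K} (p : Fin K → Bool) → 2 ≤ countFin p → ∃[ r ] ∃[ s ] (r ≢ s × T (p r) × T (p s))
countFin≥2⇒∃₂ {suc K} p h with p zero in eq
countFin≥2⇒∃₂ {suc K} p (s≤s h) | true with countFin≥1⇒∃ (p ∘′ suc) h
... | s , ts = zero , suc s , (λ ()) , subst T (sym eq) _ , ts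
countFin≥2⇒∃₂ {suc K} p h | false with countFin≥2⇒∃₂ (p ∘′ suc) h
... | r , s , r≢s , tr , ts = suc r , suc s , r≢s ∘′ suc-injective , tr , ts

sum≡2-cases : ∀ m k → m + k ≡ 2 → 2 ≤ m ⊎ 2 ≤ k ⊎ (1 ≤ m × 1 ≤ k)
sum≡2-cases (suc (suc _)) _ _    = inj₁ (s≤s (s≤s z≤n))
sum≡2-cases zero          _ refl = inj₂ (inj₁ ≤-refl)
sum≡2-cases (suc zero)    _ refl = inj₂ (inj₂ (≤-refl , ≤-refl))

module _ {n K} (I : SF n) (Π : Fin K → List (Fin n)) (gsp : IsGSP I Π) where
  open SF I
  open IsGSP gsp

  private variable
    t u : Fin K
    a b c i j p q : Fin n

  NoTransposition : Fin n → Fin n → Set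
  NoTransposition i j = ¬ (∃[ r ] IsTransposition (Π r) i j)

  NoTransposition-sym : NoTransposition i j → NoTransposition j i
  NoTransposition-sym noτ (r , τ) = noτ (r , swap τ)

  unique : ∀ t → Unique (Π t)
  unique t = IsCycle.unique (cycles t)

  long-succ≻pred : Long (Π t) → Maps (Π t) a b → ∃[ p ] (Maps (Π t) p a × b ≻[ a ] p)
  long-succ≻pred {t} {a} {b} long m with ∈⇒∃-pred (Maps⇒∈ˡ m)
  ... | p , mp with F1 t a b p (Maps⇒maps m) (Maps⇒maps mp)
  ... | inj₁ b≻p  = p , mp , b≻p
  ... | inj₂ refl = ⊥-elim (Maps-asym (unique t) long m mp)

  long-pred⇒NoTransposition : Long (Π t) → Maps (Π t) p a → NoTransposition a p
  long-pred⇒NoTransposition {t} {p} {a} long mp (v , τ) =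
    <-irrefl refl (≤-trans (+-mono-≤ a↦p p↦a) (F4 a p a≢p))
    where
      a≢p : a ≢ p
      a≢p refl = Maps-irrefl (unique t) long mp
      v≢t : v ≢ t
      v≢t refl = IsTransposition⇒¬Long τ long
      a↦p : 1 ≤ nMaps I Π a p
      a↦p = ∃⇒countFin≥1 _ v (Maps⇒maps (proj₁ (IsTransposition⇒Maps τ)))
      p↦a : 2 ≤ nMaps I Π p a
      p↦a = ∃₂⇒countFin≥2 _ v t v≢t (Maps⇒maps (proj₂ (IsTransposition⇒Maps τ))) (Maps⇒maps mp)

  -- (a, p) would block: a prefers p to its predecessor q in Π u, and p prefers its
  -- successor a in Π t to its predecessor there.
  long-pred-not-≻ : Long (Π t) → Maps (Π t) p a → Maps (Π u) q a → ¬ p ≻[ a ] q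
  long-pred-not-≻ {t} {p} {a} {u} {q} long mp mq p≻q with long-succ≻pred long mp
  ... | q′ , mq′ , a≻q′ =
    F2 a p a≢p (long-pred⇒NoTransposition long mp)
      ((u , q , Maps⇒maps mq , p≻q) , (t , q′ , Maps⇒maps mq′ , a≻q′))
    where
      a≢p : a ≢ p
      a≢p refl = Maps-irrefl (unique t) long mp

  long-pred-unique : Long (Π t) → Long (Π u) → Maps (Π t) p a → Maps (Π u) q a → p ≡ q
  long-pred-unique {_} {_} {p} {a} {q} long-t long-u mp mq with <-cmp (rank a p) (rank a q)
  ... | tri< p≻q _ _ = ⊥-elim (long-pred-not-≻ long-t mp mq p≻q)
  ... | tri≈ _ e _   = rank-inj a e
  ... | tri> _ _ q≻p = ⊥-elim (long-pred-not-≻ long-u mq mp q≻p)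

  long-Maps-transfer : Long (Π t) → Long (Π u) → Maps (Π t) a b → b ∈ Π u → Maps (Π u) a b
  long-Maps-transfer {u = u} {b = b} long-t long-u m b∈u with ∈⇒∃-pred b∈u
  ... | q , mq = subst (λ x → Maps (Π u) x b) (sym (long-pred-unique long-t long-u m mq)) mq

  long-cycles-overlap⇒⊆ : Long (Π t) → Long (Π u) → c ∈ Π t → c ∈ Π u → ∀ {y} → y ∈ Π t → y ∈ Π u
  long-cycles-overlap⇒⊆ {u = u} long-t long-u =
    pred-closed⇒∀∈ (_∈ Π u) (λ m b∈u → Maps⇒∈ˡ (long-Maps-transfer long-t long-u m b∈u))

  long-cycles-overlap⇒Maps : Long (Π t) → Long (Π u) → c ∈ Π t → c ∈ Π u → Maps (Π t) a b → Maps (Π u) a b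
  long-cycles-overlap⇒Maps long-t long-u c∈t c∈u m =
    long-Maps-transfer long-t long-u m (long-cycles-overlap⇒⊆ long-t long-u c∈t c∈u (Maps⇒∈ʳ m))

  long-cycles-disjoint : t ≢ u → Long (Π t) → Long (Π u) → c ∈ Π t → ¬ c ∈ Π u
  long-cycles-disjoint {t} {u} t≢u long-t long-u c∈t c∈u with distinct t u t≢u
  ... | inj₁ (singleton , _)  = Long⇒¬IsFixedPoint {C = Π t} long-t singleton
  ... | inj₂ (a , b , differ) =
    differ (maps-cong (long-cycles-overlap⇒Maps long-t long-u c∈t c∈u)
                      (long-cycles-overlap⇒Maps long-u long-t c∈u c∈t))

  long-unless-transposition : i ≢ j → NoTransposition i j → Maps (Π t) i j → Long (Π t)
  long-unless-transposition {t = t} i≢j noτ m with Maps⇒IsTransposition⊎Long m i≢j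
  ... | inj₁ τ    = ⊥-elim (noτ (t , τ))
  ... | inj₂ long = long

  nMaps≥1⇒∃ : 1 ≤ nMaps I Π a b → ∃[ t ] Maps (Π t) a b
  nMaps≥1⇒∃ h with countFin≥1⇒∃ _ h
  ... | t , mt = t , maps⇒Maps _ mt

  nMaps≥2⇒∃₂ : 2 ≤ nMaps I Π a b → ∃[ t ] ∃[ u ] (t ≢ u × Maps (Π t) a b × Maps (Π u) a b)
  nMaps≥2⇒∃₂ h with countFin≥2⇒∃₂ _ h
  ... | t , u , t≢u , mt , mu = t , u , t≢u , maps⇒Maps _ mt , maps⇒Maps _ mu

  NoTransposition⇒¬nMaps≥2 : i ≢ j → NoTransposition i j → ¬ 2 ≤ nMaps I Π i j
  NoTransposition⇒¬nMaps≥2 i≢j noτ two with nMaps≥2⇒∃₂ two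
  ... | t , u , t≢u , mt , mu =
    long-cycles-disjoint t≢u (long-unless-transposition i≢j noτ mt) (long-unless-transposition i≢j noτ mu)
      (Maps⇒∈ˡ mt) (Maps⇒∈ˡ mu)

  NoTransposition⇒¬mutual : i ≢ j → NoTransposition i j → 1 ≤ nMaps I Π i j → ¬ 1 ≤ nMaps I Π j i
  NoTransposition⇒¬mutual i≢j noτ ij ji with nMaps≥1⇒∃ ij | nMaps≥1⇒∃ ji
  ... | t , mt | u , mu
    with long-succ≻pred (long-unless-transposition i≢j noτ mt) mt
       | long-succ≻pred (long-unless-transposition (i≢j ∘′ sym) (NoTransposition-sym noτ) mu) mu
  ... | p , mp , j≻p | q , mq , i≻q =
    F2 _ _ i≢j noτ ((t , p , Maps⇒maps mp , j≻p) , (u , q , Maps⇒maps mq , i≻q))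

theorem4 : ∀ {n K} (I : SF n) (Π : Fin K → List (Fin n)) → IsGSP I Π →
           ∀ i j → i ≢ j → nMaps I Π i j + nMaps I Π j i ≡ 2 →
           ∃[ r ] IsTransposition (Π r) i j
theorem4 I Π gsp i j i≢j two with any? (λ r → IsTransposition? (Π r) i j)
... | yes τ   = τ
... | no noτ with sum≡2-cases (nMaps I Π i j) (nMaps I Π j i) two
...   | inj₁ ij≥2             = ⊥-elim (NoTransposition⇒¬nMaps≥2 I Π gsp i≢j noτ ij≥2)
...   | inj₂ (inj₁ ji≥2)      =
  ⊥-elim (NoTransposition⇒¬nMaps≥2 I Π gsp (i≢j ∘′ sym) (NoTransposition-sym I Π gsp noτ) ji≥2)
...   | inj₂ (inj₂ (ij , ji)) = ⊥-elim (NoTransposition⇒¬mutual I Π gsp i≢j noτ ij ji)
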